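{- Let $(X,S)$ be an association scheme of order $n$ and let $H$ be an $n\times n$ Hadamard matrix whose rows and columns are indexed by the elements of $X$. Let $\widetilde{X}$ and $S(H)$ be as defined in the context. Then $(\widetilde{X}, S(H))$ is an association scheme.
   Context: An association scheme is a pair $(X,S)$ where $X$ is a nonempty finite set and $S$ is a partition of $X\times X$ such that (1) $1_X:=\{(\alpha,\alpha)\mid \alpha\in X\}\in S$; (2) for each $s\in S$, $s^*:=\{(\alpha,\beta)\mid(\beta,\alpha)\in s\}\in S$; (3) for all $s,t,u\in S$ the number $|\alpha s\cap \beta t^*|$ is the same for all $(\alpha,\beta)\in u$, where $\alpha s:=\{\beta\in X\mid(\alpha,\beta)\in s\}$. Its order is $|X|$. A Hadamard matrix of order $n$ is an $n\times n$ matrix $H$ with entries $\pm1$ and $HH^T=nI$. Construction: Let $\mathbb{F}_2$ be the field with two elements, and write $x_{ab}$ for $(x,a,b)\in X\times\mathbb{F}_2\times\mathbb{F}_2$. For $a\in\mathbb{F}_2$ let $H^{T(a)}=H$ if $a=0$ and $H^{T(a)}=H^T$ if $a=1$; let $\delta_{ac}=1$ if $a=c$ and $0$ otherwise. Define $\widetilde{X}=\{x_{ab}\mid x\in X,\ a,b\in\mathbb{F}_2\}$; $\widetilde{t}=\{(x_{ab},x_{a(b+1)})\mid x\in X,\ a,b\in\mathbb{F}_2\}$; for $s\in S\setminus\{1_X\}$, $\widetilde{s}=\{(x_{ab},y_{ac})\mid (x,y)\in s,\ a,b,c\in\mathbb{F}_2\}$; $r^1_H=\{(x_{ab},y_{cd})\mid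 x,y\in X,\ a,b,c,d\in\mathbb{F}_2,\ (1-\delta_{ac})(H^{T(a)})_{xy}=(-1)^{b+d}\}$; $r^{ -1}_H=\{(x_{ab},y_{cd})\mid x,y\in X,\ a,b,c,d\in\mathbb{F}_2,\ a\neq c\}\setminus r^1_H$; $S(H)=\{1_{\widetilde{X}},\widetilde{t}\}\cup\{\widetilde{s}\mid s\in S\setminus\{1_X\}\}\cup\{r^1_H,r^{ -1}_H\}$. -}

module Defs where

open import Data.Nat using (ℕ; zero; suc; _+_)
open import Data.Bool using (Bool; true; false; not; _∧_; _xor_; if_then_else_)
open import Data.Fin using (Fin; zero; suc)
open import Data.Integer using (ℤ; +_; -[1+_]; _*_)
import Data.Integer as ℤ
import Data.Fin as Fin
import Data.Bool as B
open import Data.Product using (Σ; ∃; _×_; _,_)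
open import Data.Sum using (_⊎_)
open import Relation.Nullary using (¬_)
open import Relation.Nullary.Decidable using (⌊_⌋)
open import Relation.Binary.PropositionalEquality using (_≡_)
open import Function.Bundles using (_⇔_)

sumℕ : ∀ {n} → (Fin n → ℕ) → ℕ
sumℕ {zero}  f = 0
sumℕ {suc n} f = f zero + sumℕ (λ i → f (suc i))

sumℤ : ∀ {n} → (Fin n → ℤ) → ℤ
sumℤ {zero}  f = + 0
sumℤ {suc n} f = f zero ℤ.+ sumℤ (λ i → f (suc i))

b2n : Bool → ℕ
b2n true  = 1
b2n false = 0

countFin : ∀ {n} → (Fin n → Bool) → ℕ
countFin p = sumℕ (λ x → b2n (p x))

sumBool : (Bool → ℕ) → ℕ
sumBool f = f false + f true

countBool : (Bool → Bool) → ℕ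
countBool p = b2n (p false) + b2n (p true)

-- The set S of relations is given
-- as a family  R : I → X → X → Bool  (S is the image of the family); two
-- indices denote the same element of S iff they have the same pairs.
-- `#` counts the elements of X satisfying a boolean predicate.

SameRel : ∀ {X : Set} → (X → X → Bool) → (X → X → Bool) → Set
SameRel r r' = ∀ α β → r α β ≡ r' α β

record IsAssocScheme (X : Set) (# : (X → Bool) → ℕ)
                     (I : Set) (R : I → X → X → Bool) : Set₁ where
  field
    nonempty    : X
    -- S is a partition of X × X: blocks nonempty, every pair lies in a block,
    -- and a pair lying in two blocks forces the blocks to coincide
    blockNonempty : ∀ s → ∃ λ α → ∃ λ β → R s α β ≡ true
    cover       : ∀ α β → ∃ λ s → R s α β ≡ true
    disjoint    : ∀ s s' α β → R s α β ≡ true → R s' α β ≡ true → SameRel (R s) (R s')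
    identity    : ∃ λ i → ∀ α β → (R i α β ≡ true) ⇔ (α ≡ β)
    transpose   : ∀ s → ∃ λ s* → ∀ α β → R s* α β ≡ R s β α
    -- (3) |α s ∩ β t*| depends only on the relation u containing (α,β);
    --     β t* = { γ | (γ,β) ∈ t }
    regular     : ∀ s t u α β α' β' → R u α β ≡ true → R u α' β' ≡ true →
                  # (λ γ → R s α γ ∧ R t γ β) ≡ # (λ γ → R s α' γ ∧ R t γ β')

_==ℤ_ : ℤ → ℤ → Bool
a ==ℤ b = ⌊ a ℤ.≟ b ⌋

_==F_ : ∀ {n} → Fin n → Fin n → Bool
a ==F b = ⌊ a Fin.≟ b ⌋

_==B_ : Bool → Bool → Bool
a ==B b = ⌊ a B.≟ b ⌋

record IsHadamard (n : ℕ) (H : Fin n → Fin n → ℤ) : Set where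
  field
    entries : ∀ i j → (H i j ≡ + 1) ⊎ (H i j ≡ -[1+ 0 ])
    orth    : ∀ i j → sumℤ (λ k → H i k * H j k) ≡ (if i ==F j then + n else + 0)

-- The construction.  𝔽₂ is modelled by Bool (false = 0, true = 1,
-- addition = xor).  x_ab is (x , a , b).

F₂ : Set
F₂ = Bool

X̃ : ℕ → Set
X̃ n = Fin n × F₂ × F₂

countX̃ : ∀ {n} → (X̃ n → Bool) → ℕ
countX̃ p = sumℕ (λ x → sumBool (λ a → countBool (λ b → p (x , a , b))))

sgn : F₂ → ℤ
sgn false = + 1
sgn true  = -[1+ 0 ]

HT : ∀ {n} → (Fin n → Fin n → ℤ) → F₂ → Fin n → Fin n → ℤ
HT H false x y = H x y
HT H true  x y = H y x

oneMinusδ : F₂ → F₂ → ℤ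
oneMinusδ a c = if a ==B c then + 0 else + 1

data Ĩ {n : ℕ} (I : Set) (R : I → Fin n → Fin n → Bool) : Set where
  one   : Ĩ I R
  tt̃    : Ĩ I R
  tilde : (s : I) → ¬ SameRel (R s) (λ x y → x ==F y) → Ĩ I R
  r⁺    : Ĩ I R
  r⁻    : Ĩ I R

inR¹ : ∀ {n} → (Fin n → Fin n → ℤ) → X̃ n → X̃ n → Bool
inR¹ H (x , a , b) (y , c , d) = ((oneMinusδ a c) * HT H a x y) ==ℤ sgn (b xor d)

SH : ∀ {n} (I : Set) (R : I → Fin n → Fin n → Bool) (H : Fin n → Fin n → ℤ) →
     Ĩ I R → X̃ n → X̃ n → Bool
SH I R H one (x , a , b) (y , c , d) = (x ==F y) ∧ (a ==B c) ∧ (b ==B d)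
SH I R H tt̃ (x , a , b) (y , c , d) = (x ==F y) ∧ (a ==B c) ∧ (d ==B not b)
SH I R H (tilde s _) (x , a , b) (y , c , d) = R s x y ∧ (a ==B c)
SH I R H r⁺ p q = inR¹ H p q
SH I R H r⁻ (x , a , b) (y , c , d) =
  not (a ==B c) ∧ not (inR¹ H (x , a , b) (y , c , d))

-- A relation of S(H) is determined by three data: the change of layer a ↦ c (0 for 1, t̃ and s̃,
-- 1 for r^{±1}_H), a relation between x and y (equality, some s ∈ S, or everything), and a condition
-- on the sign bits: none (for s̃), or b + d = g for a bit g depending on a, x, y (g = 0, 1 for 1, t̃,
-- and g = τ + ε_a(x, y) for r^{(-1)^τ}_H, where (-1)^{ε_a(x, y)} = H^{T(a)}_{xy}). Summing over the
-- middle point z_ef, the layer e is forced and the count over f is explicit, so |α s ∩ β t*| is a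
-- layer indicator times a sum over z ∈ X. That this sum depends only on the relation u ∋ (α, β)
-- follows by cases on the kinds of s and t: it reduces to Kronecker deltas, intersection numbers and
-- valencies of (X, S), except for s, t ∈ {r^1_H, r^{-1}_H} with u = s̃. There it counts the z at which
-- two distinct rows of H^{T(a)} agree (or disagree), which is n/2 because the rows of H and of H^T
-- are orthogonal.

module Submission where

open import Defs
open import Algebra.Bundles using (Semiring; CommutativeMonoid; CommutativeRing)
import Algebra.Properties.Semiring.Sum as SemiringSum
open import Data.Bool using (Bool; true; false; not; _∧_; _xor_; if_then_else_)
import Data.Bool as B
open import Data.Bool.Properties
  using (T-≡; ¬-not; ⇔→≡; ∧-idem; ∧-comm; ∧-identityʳ; ∧-zeroʳ; ∧-conicalˡ; ∧-conicalʳ;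
         xor-assoc; xor-comm; xor-same; xor-identityʳ; xor-∧-commutativeRing; ∧-commutativeMonoid)
open import Algebra.Properties.CommutativeSemigroup
  (CommutativeRing.+-commutativeSemigroup xor-∧-commutativeRing)
  using () renaming (interchange to xor-interchange)
open import Algebra.Properties.CommutativeSemigroup
  (CommutativeMonoid.commutativeSemigroup ∧-commutativeMonoid)
  using () renaming (x∙yz≈y∙xz to ∧-swapˡ)
open import Data.Empty using (⊥-elim)
open import Data.Fin using (Fin; zero; suc)
import Data.Fin as Fin
open import Data.Integer as ℤ using (ℤ; +_; -[1+_]; ∣_∣)
import Data.Integer.Properties as ℤP
open import Data.Nat as ℕ using (ℕ; zero; suc; _≤_)
import Data.Nat.Properties as ℕP
open import Data.Product using (Σ; _×_; _,_; proj₁; proj₂)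
open import Data.Sum using (_⊎_; inj₁; inj₂)
open import Function.Base using (_∘_)
open import Function.Bundles using (Equivalence; _⇔_; mk⇔)
open import Relation.Binary.Definitions using (DecidableEquality)
open import Relation.Binary.PropositionalEquality
  using (_≡_; _≢_; refl; sym; trans; cong; cong₂; subst; module ≡-Reasoning)
open import Relation.Nullary.Negation using (¬_)
open import Relation.Nullary.Decidable
  using (⌊_⌋; yes; no; toWitness; isYes≗does; dec-true; dec-false; does-⇔; ⌊⌋-map′)

module ℕ∑ = SemiringSum ℕP.+-*-semiring
module ℤ∑ = SemiringSum ℤP.+-*-semiring

module DecidableBool {A : Set} (_≟_ : DecidableEquality A) where

  ⌊≟⌋-refl : ∀ x → ⌊ x ≟ x ⌋ ≡ true
  ⌊≟⌋-refl x = trans (isYes≗does (x ≟ x)) (dec-true (x ≟ x) refl)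

  ⌊≟⌋-≢ : ∀ {x y} → x ≢ y → ⌊ x ≟ y ⌋ ≡ false
  ⌊≟⌋-≢ {x} {y} x≢y = trans (isYes≗does (x ≟ y)) (dec-false (x ≟ y) x≢y)

  ⌊≟⌋⇒≡ : ∀ {x y} → ⌊ x ≟ y ⌋ ≡ true → x ≡ y
  ⌊≟⌋⇒≡ e = toWitness (Equivalence.from T-≡ e)

  ⌊≟⌋-sym : ∀ x y → ⌊ x ≟ y ⌋ ≡ ⌊ y ≟ x ⌋
  ⌊≟⌋-sym x y = trans (isYes≗does (x ≟ y))
    (trans (does-⇔ (mk⇔ sym sym) (x ≟ y) (y ≟ x)) (sym (isYes≗does (y ≟ x))))

module _ {m : ℕ} where
  open DecidableBool (Fin._≟_ {m}) public
    renaming (⌊≟⌋-refl to ==F-refl; ⌊≟⌋-≢ to ==F-≢; ⌊≟⌋⇒≡ to ==F⇒≡;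
              ⌊≟⌋-sym to ==F-sym)

open DecidableBool B._≟_
  using () renaming (⌊≟⌋-refl to ==B-refl; ⌊≟⌋⇒≡ to ==B⇒≡; ⌊≟⌋-sym to ==B-sym)

==F-suc : ∀ {m} (x y : Fin m) → (Fin.suc x ==F suc y) ≡ (x ==F y)
==F-suc x y = ⌊⌋-map′ _ _ (x Fin.≟ y)

==B-xor-cancelʳ : ∀ p q b → ((p xor b) ==B (q xor b)) ≡ (p ==B q)
==B-xor-cancelʳ false false false = refl
==B-xor-cancelʳ false false true  = refl
==B-xor-cancelʳ false true  false = refl
==B-xor-cancelʳ false true  true  = refl
==B-xor-cancelʳ true  false false = refl
==B-xor-cancelʳ true  false true  = refl
==B-xor-cancelʳ true  true  false = refl
==B-xor-cancelʳ true  true  true  = refl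

xor-xor-cancel : ∀ p e → (p xor e) xor e ≡ p
xor-xor-cancel p e = trans (xor-assoc p e e) (trans (cong (p xor_) (xor-same e)) (xor-identityʳ p))

xor-cancelʳ : ∀ {p q} e → p xor e ≡ q xor e → p ≡ q
xor-cancelʳ {p} {q} e eq = trans (sym (xor-xor-cancel p e)) (trans (cong (_xor e) eq) (xor-xor-cancel q e))

xor-shift-==B : ∀ p q r b → ((p xor b) ==B (q xor (r xor b))) ≡ (p ==B (q xor r))
xor-shift-==B p q r b =
  trans (cong ((p xor b) ==B_) (sym (xor-assoc q r b))) (==B-xor-cancelʳ p (q xor r) b)

==B-as-xor : ∀ b d → (b ==B d) ≡ ((b xor d) ==B false)
==B-as-xor false false = refl
==B-as-xor false true  = refl
==B-as-xor true  false = refl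
==B-as-xor true  true  = refl

==B-not-as-xor : ∀ b d → (d ==B not b) ≡ ((b xor d) ==B true)
==B-not-as-xor false false = refl
==B-not-as-xor false true  = refl
==B-not-as-xor true  false = refl
==B-not-as-xor true  true  = refl

not-==B : ∀ p e → not (p ==B e) ≡ (p ==B not e)
not-==B false false = refl
not-==B false true  = refl
not-==B true  false = refl
not-==B true  true  = refl

module _ {c ℓ} (R : Semiring c ℓ) where
  open Semiring R using (Carrier; _≈_; _+_; _*_; 0#; setoid; +-congˡ; +-identityˡ; +-identityʳ; *-assoc)
  open SemiringSum R
  open import Relation.Binary.Reasoning.Setoid setoid

  ∑-δ : ∀ {m} (l : Fin m) (f : Fin m → Carrier) →
        sum (λ k → if k ==F l then f k else 0#) ≈ f l
  ∑-δ {suc m} zero f = begin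
    f zero + sum {m} (λ _ → 0#)  ≈⟨ +-congˡ (sum-replicate-zero m) ⟩
    f zero + 0#                  ≈⟨ +-identityʳ (f zero) ⟩
    f zero                       ∎
  ∑-δ {suc m} (suc l) f = begin
    0# + sum (λ k → if suc k ==F suc l then f (suc k) else 0#)
      ≈⟨ +-identityˡ _ ⟩
    sum (λ k → if suc k ==F suc l then f (suc k) else 0#)
      ≡⟨ sum-cong-≗ (λ k → cong (if_then f (suc k) else 0#) (==F-suc k l)) ⟩
    sum (λ k → if k ==F l then f (suc k) else 0#)
      ≈⟨ ∑-δ l (f ∘ suc) ⟩
    f (suc l) ∎

  ∑-∑-assoc : ∀ {m k} (a : Fin m → Carrier) (B : Fin m → Fin k → Carrier) (c : Fin k → Carrier) →
              sum (λ j → sum (λ i → a i * B i j) * c j)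
              ≈ sum (λ i → a i * sum (λ j → B i j * c j))
  ∑-∑-assoc a B c = begin
    sum (λ j → sum (λ i → a i * B i j) * c j)
      ≈⟨ sum-cong-≋ (λ j → *-distribʳ-sum (c j) (λ i → a i * B i j)) ⟩
    sum (λ j → sum (λ i → (a i * B i j) * c j))
      ≈⟨ ∑-comm (λ j i → (a i * B i j) * c j) ⟩
    sum (λ i → sum (λ j → (a i * B i j) * c j))
      ≈⟨ sum-cong-≋ (λ i → sum-cong-≋ (λ j → *-assoc (a i) (B i j) (c j))) ⟩
    sum (λ i → sum (λ j → a i * (B i j * c j)))
      ≈⟨ sum-cong-≋ (λ i → *-distribˡ-sum (a i) (λ j → B i j * c j)) ⟨
    sum (λ i → a i * sum (λ j → B i j * c j)) ∎

open ℕ∑ using (sum; sum-cong-≗)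

term≤∑ : ∀ {m} (f : Fin m → ℕ) i → f i ≤ sum f
term≤∑ f zero    = ℕP.m≤m+n (f zero) _
term≤∑ f (suc i) = ℕP.≤-trans (term≤∑ (f ∘ suc) i) (ℕP.m≤n+m _ (f zero))

two-terms≤∑ : ∀ {m} (f : Fin m → ℕ) {i j} → i ≢ j → f i ℕ.+ f j ≤ sum f
two-terms≤∑ f {zero}  {zero}  i≢j = ⊥-elim (i≢j refl)
two-terms≤∑ f {zero}  {suc j} _   = ℕP.+-monoʳ-≤ (f zero) (term≤∑ (f ∘ suc) j)
two-terms≤∑ f {suc i} {zero}  _   =
  subst (_≤ sum f) (ℕP.+-comm (f zero) (f (suc i))) (ℕP.+-monoʳ-≤ (f zero) (term≤∑ (f ∘ suc) i))
two-terms≤∑ f {suc i} {suc j} i≢j =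
  ℕP.≤-trans (two-terms≤∑ (f ∘ suc) (i≢j ∘ cong suc)) (ℕP.m≤n+m _ (f zero))

∑≡term⇒others≡0 : ∀ {m} (f : Fin m → ℕ) i → sum f ≡ f i → ∀ j → j ≢ i → f j ≡ 0
∑≡term⇒others≡0 f i ∑≡fi j j≢i =
  ℕP.n≤0⇒n≡0 (ℕP.+-cancelˡ-≤ (f i) _ _
    (subst (f i ℕ.+ f j ≤_) (trans ∑≡fi (sym (ℕP.+-identityʳ (f i)))) (two-terms≤∑ f (j≢i ∘ sym))))

∑-one : ∀ m → sum {m} (λ _ → 1) ≡ m
∑-one zero    = refl
∑-one (suc m) = cong suc (∑-one m)

sumℕ≡∑ : ∀ {m} (f : Fin m → ℕ) → sumℕ f ≡ sum f
sumℕ≡∑ {zero}  f = refl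
sumℕ≡∑ {suc m} f = cong (f zero ℕ.+_) (sumℕ≡∑ (f ∘ suc))

sumℕ-cong : ∀ {m} {f g : Fin m → ℕ} → (∀ i → f i ≡ g i) → sumℕ f ≡ sumℕ g
sumℕ-cong {f = f} {g} f≗g = trans (sumℕ≡∑ f) (trans (sum-cong-≗ f≗g) (sym (sumℕ≡∑ g)))

countFin-cong : ∀ {m} {p q : Fin m → Bool} → (∀ z → p z ≡ q z) → countFin p ≡ countFin q
countFin-cong p≗q = sumℕ-cong (cong b2n ∘ p≗q)

b2n-∧-if : ∀ A B k → b2n (A ∧ B) ℕ.* k ≡ (if B then b2n A ℕ.* k else 0)
b2n-∧-if A false k = cong (λ w → b2n w ℕ.* k) (∧-zeroʳ A)
b2n-∧-if A true  k = cong (λ w → b2n w ℕ.* k) (∧-identityʳ A)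

∑-δʳ : ∀ {m} (y : Fin m) (P : Fin m → Bool) (g : Fin m → ℕ) →
       sum (λ z → b2n (P z ∧ (z ==F y)) ℕ.* g z) ≡ b2n (P y) ℕ.* g y
∑-δʳ y P g = trans (sum-cong-≗ (λ z → b2n-∧-if (P z) (z ==F y) (g z)))
                   (∑-δ ℕP.+-*-semiring y (λ z → b2n (P z) ℕ.* g z))

∑-δˡ : ∀ {m} (x : Fin m) (P : Fin m → Bool) (g : Fin m → ℕ) →
       sum (λ z → b2n ((x ==F z) ∧ P z) ℕ.* g z) ≡ b2n (P x) ℕ.* g x
∑-δˡ x P g = trans (sum-cong-≗ (λ z → cong (λ w → b2n w ℕ.* g z) (swap z))) (∑-δʳ x P g)
  where
  swap : ∀ z → ((x ==F z) ∧ P z) ≡ (P z ∧ (z ==F x))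
  swap z = trans (∧-comm (x ==F z) (P z)) (cong (P z ∧_) (==F-sym x z))

sumℤ≡∑ : ∀ {m} (f : Fin m → ℤ) → sumℤ f ≡ ℤ∑.sum f
sumℤ≡∑ {zero}  f = refl
sumℤ≡∑ {suc m} f = cong (ℤ._+_ (f zero)) (sumℤ≡∑ (f ∘ suc))

∑-pos : ∀ {m} (f : Fin m → ℕ) → ℤ∑.sum (+_ ∘ f) ≡ + sum f
∑-pos {zero}  f = refl
∑-pos {suc m} f = trans (cong (ℤ._+_ (+ f zero)) (∑-pos (f ∘ suc))) (sym (ℤP.pos-+ (f zero) _))

sgn-xor : ∀ p q → sgn (p xor q) ≡ sgn p ℤ.* sgn q
sgn-xor false false = refl
sgn-xor false true  = refl
sgn-xor true  false = refl
sgn-xor true  true  = refl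

sgn-indicator : ∀ p q → sgn (not p) ℤ.* sgn q ℤ.+ + (2 ℕ.* b2n (p ==B q)) ≡ + 1
sgn-indicator false false = refl
sgn-indicator false true  = refl
sgn-indicator true  false = refl
sgn-indicator true  true  = refl

signBit : ℤ → F₂
signBit (+ _)    = false
signBit -[1+ _ ] = true

sgn-signBit : ∀ {h} → h ≡ + 1 ⊎ h ≡ -[1+ 0 ] → sgn (signBit h) ≡ h
sgn-signBit (inj₁ refl) = refl
sgn-signBit (inj₂ refl) = refl

*-self : ∀ i → i ℤ.* i ≡ + (∣ i ∣ ℕ.* ∣ i ∣)
*-self (+ m)    = ℤP.+◃n≡+n _
*-self -[1+ m ] = ℤP.+◃n≡+n _

balanced : ∀ {m} (e : Fin m → F₂) → ℤ∑.sum (sgn ∘ e) ≡ + 0 →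
           ∀ p → 2 ℕ.* sum (λ z → b2n (p ==B e z)) ≡ m
balanced {m} e ∑sgn≡0 p = ℤP.+-injective (begin
  + (2 ℕ.* sum g)
    ≡⟨ cong +_ (ℕ∑.*-distribˡ-sum 2 g) ⟩
  + sum (λ z → 2 ℕ.* g z)
    ≡⟨ ∑-pos (λ z → 2 ℕ.* g z) ⟨
  twice
    ≡⟨ ℤP.+-identityˡ twice ⟨
  + 0 ℤ.+ twice
    ≡⟨ cong (ℤ._+ twice) (trans (cong (sgn (not p) ℤ.*_) ∑sgn≡0) (ℤP.*-zeroʳ (sgn (not p)))) ⟨
  sgn (not p) ℤ.* ℤ∑.sum (sgn ∘ e) ℤ.+ twice
    ≡⟨ cong (ℤ._+ twice) (ℤ∑.*-distribˡ-sum (sgn (not p)) (sgn ∘ e)) ⟩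
  ℤ∑.sum (λ z → sgn (not p) ℤ.* sgn (e z)) ℤ.+ twice
    ≡⟨ ℤ∑.∑-distrib-+ (λ z → sgn (not p) ℤ.* sgn (e z)) (λ z → + (2 ℕ.* g z)) ⟨
  ℤ∑.sum (λ z → sgn (not p) ℤ.* sgn (e z) ℤ.+ + (2 ℕ.* g z))
    ≡⟨ ℤ∑.sum-cong-≗ (λ z → sgn-indicator p (e z)) ⟩
  ℤ∑.sum {m} (λ _ → + 1)
    ≡⟨ ∑-pos {m} (λ _ → 1) ⟩
  + sum {m} (λ _ → 1)
    ≡⟨ cong +_ (∑-one m) ⟩
  + m ∎)
  where
  open ≡-Reasoning
  g : Fin m → ℕ
  g z = b2n (p ==B e z)
  twice : ℤ
  twice = ℤ∑.sum (λ z → + (2 ℕ.* g z))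

*-if : ∀ x b y → x ℤ.* (if b then y else + 0) ≡ (if b then x ℤ.* y else + 0)
*-if x false y = ℤP.*-zeroʳ x
*-if x true  y = refl

module Hadamard {n : ℕ} {H : Fin n → Fin n → ℤ} (isHad : IsHadamard n H) where
  open IsHadamard isHad
  open import Data.Integer.Base using (_+_; _*_)
  open ℤ∑ using () renaming (sum to ∑; sum-cong-≗ to ∑-cong)
  open ≡-Reasoning

  entry² : ∀ i j → H i j * H i j ≡ + 1
  entry² i j with entries i j
  ... | inj₁ eq rewrite eq = refl
  ... | inj₂ eq rewrite eq = refl

  rows-orth : ∀ i j → ∑ (λ k → H i k * H j k) ≡ (if i ==F j then + n else + 0)
  rows-orth i j = trans (sym (sumℤ≡∑ (λ k → H i k * H j k))) (orth i j)

  Gram : Fin n → Fin n → ℤ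
  Gram i j = ∑ (λ k → H k i * H k j)

  Gram-diag : ∀ i → Gram i i ≡ + n
  Gram-diag i = trans (∑-cong (λ k → entry² k i)) (trans (∑-pos {n} (λ _ → 1)) (cong +_ (∑-one n)))

  Gram-times-row : ∀ i l → ∑ (λ j → H l j * Gram i j) ≡ H l i * + n
  Gram-times-row i l = begin
    ∑ (λ j → H l j * Gram i j)
      ≡⟨ ∑-cong (λ j → ℤP.*-comm (H l j) (Gram i j)) ⟩
    ∑ (λ j → Gram i j * H l j)
      ≡⟨ ∑-∑-assoc ℤP.+-*-semiring (λ k → H k i) H (H l) ⟩
    ∑ (λ k → H k i * ∑ (λ j → H k j * H l j))
      ≡⟨ ∑-cong (λ k → trans (cong (H k i *_) (rows-orth k l)) (*-if (H k i) (k ==F l) (+ n))) ⟩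
    ∑ (λ k → if k ==F l then H k i * + n else + 0)
      ≡⟨ ∑-δ ℤP.+-*-semiring l (λ k → H k i * + n) ⟩
    H l i * + n ∎

  Gram-norm² : ∀ i → ∑ (λ j → Gram i j * Gram i j) ≡ + n * + n
  Gram-norm² i = begin
    ∑ (λ j → Gram i j * Gram i j)
      ≡⟨ ∑-∑-assoc ℤP.+-*-semiring (λ l → H l i) H (Gram i) ⟩
    ∑ (λ l → H l i * ∑ (λ j → H l j * Gram i j))
      ≡⟨ ∑-cong (λ l → cong (H l i *_) (Gram-times-row i l)) ⟩
    ∑ (λ l → H l i * (H l i * + n))
      ≡⟨ ∑-cong (λ l → trans (sym (ℤP.*-assoc (H l i) (H l i) (+ n)))
                             (cong (_* + n) (entry² l i))) ⟩
    ∑ {n} (λ _ → + 1 * + n)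
      ≡⟨ ℤ∑.*-distribʳ-sum {n} (+ n) (λ _ → + 1) ⟨
    ∑ {n} (λ _ → + 1) * + n
      ≡⟨ cong (_* + n) (trans (∑-pos {n} (λ _ → 1)) (cong +_ (∑-one n))) ⟩
    + n * + n ∎

  -- Σ_j (Gram i j)² = n² = (Gram i i)², so the off-diagonal squares vanish.
  Gram-offdiag : ∀ {i j} → j ≢ i → Gram i j ≡ + 0
  Gram-offdiag {i} {j} j≢i =
    ℤP.∣i∣≡0⇒i≡0 (square≡0⇒≡0 (∑≡term⇒others≡0 sq i ∑sq≡sqᵢ j j≢i))
    where
    sq : Fin n → ℕ
    sq k = ∣ Gram i k ∣ ℕ.* ∣ Gram i k ∣
    ∑sq≡sqᵢ : sum sq ≡ sq i
    ∑sq≡sqᵢ = ℤP.+-injective (begin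
      + sum sq                      ≡⟨ ∑-pos sq ⟨
      ∑ (λ k → + sq k)              ≡⟨ ∑-cong (λ k → *-self (Gram i k)) ⟨
      ∑ (λ k → Gram i k * Gram i k) ≡⟨ Gram-norm² i ⟩
      + n * + n                     ≡⟨ cong₂ _*_ (Gram-diag i) (Gram-diag i) ⟨
      Gram i i * Gram i i           ≡⟨ *-self (Gram i i) ⟩
      + sq i                        ∎)
    square≡0⇒≡0 : ∀ {m} → m ℕ.* m ≡ 0 → m ≡ 0
    square≡0⇒≡0 {m} eq with ℕP.m*n≡0⇒m≡0∨n≡0 m eq
    ... | inj₁ m≡0 = m≡0
    ... | inj₂ m≡0 = m≡0

  transpose : IsHadamard n (λ i j → H j i)
  transpose = record
    { entries = λ i j → entries j i
    ; orth    = λ i j → trans (sumℤ≡∑ (λ k → H k i * H k j)) (Gram-orth i j)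
    }
    where
    Gram-orth : ∀ i j → Gram i j ≡ (if i ==F j then + n else + 0)
    Gram-orth i j with i Fin.≟ j
    ... | yes refl = Gram-diag i
    ... | no i≢j   = Gram-offdiag (i≢j ∘ sym)

  rows-balanced : ∀ {x y} → x ≢ y → ∀ c p →
    2 ℕ.* sum (λ z → b2n (p ==B (c xor (signBit (H x z) xor signBit (H y z))))) ≡ n
  rows-balanced {x} {y} x≢y c p = balanced e ∑sgn≡0 p
    where
    e : Fin n → F₂
    e z = c xor (signBit (H x z) xor signBit (H y z))
    sgn-e : ∀ z → sgn (e z) ≡ sgn c * (H x z * H y z)
    sgn-e z = begin
      sgn (e z)
        ≡⟨ sgn-xor c _ ⟩
      sgn c * sgn (signBit (H x z) xor signBit (H y z))
        ≡⟨ cong (sgn c *_) (sgn-xor (signBit (H x z)) (signBit (H y z))) ⟩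
      sgn c * (sgn (signBit (H x z)) * sgn (signBit (H y z)))
        ≡⟨ cong (sgn c *_) (cong₂ _*_ (sgn-signBit (entries x z)) (sgn-signBit (entries y z))) ⟩
      sgn c * (H x z * H y z) ∎
    ∑sgn≡0 : ∑ (sgn ∘ e) ≡ + 0
    ∑sgn≡0 = begin
      ∑ (sgn ∘ e)                        ≡⟨ ∑-cong sgn-e ⟩
      ∑ (λ z → sgn c * (H x z * H y z))  ≡⟨ ℤ∑.*-distribˡ-sum (sgn c) (λ z → H x z * H y z) ⟨
      sgn c * ∑ (λ z → H x z * H y z)    ≡⟨ cong (sgn c *_) (rows-orth x y) ⟩
      sgn c * (if x ==F y then + n else + 0)
        ≡⟨ cong (λ b → sgn c * (if b then + n else + 0)) (==F-≢ x≢y) ⟩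
      sgn c * + 0                        ≡⟨ ℤP.*-zeroʳ (sgn c) ⟩
      + 0                                ∎

HT-Hadamard : ∀ {n} {H : Fin n → Fin n → ℤ} → IsHadamard n H → ∀ a → IsHadamard n (HT H a)
HT-Hadamard isHad false = isHad
HT-Hadamard isHad true  = Hadamard.transpose isHad

module SchemeFacts {n : ℕ} {I : Set} {R : I → Fin n → Fin n → Bool}
                   (scheme : IsAssocScheme (Fin n) countFin I R) where
  open IsAssocScheme scheme
  open ≡-Reasoning

  Δ : I
  Δ = proj₁ identity

  R-Δ-refl : ∀ x → R Δ x x ≡ true
  R-Δ-refl x = Equivalence.from (proj₂ identity x x) refl

  R-Δ : ∀ x y → R Δ x y ≡ (x ==F y)
  R-Δ x y with x Fin.≟ y
  ... | yes refl = R-Δ-refl x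
  ... | no x≢y   = ¬-not (x≢y ∘ Equivalence.to (proj₂ identity x y))

  non-Δ-irreflexive : ∀ {s x y} → ¬ SameRel (R s) _==F_ → R s x y ≡ true → x ≢ y
  non-Δ-irreflexive {s} {x} s≠Δ r refl =
    s≠Δ (λ α β → trans (disjoint s Δ x x r (R-Δ-refl x) α β) (R-Δ α β))

  transpose-non-Δ : ∀ {s} → ¬ SameRel (R s) _==F_ → ¬ SameRel (R (proj₁ (transpose s))) _==F_
  transpose-non-Δ {s} s≠Δ same =
    s≠Δ λ x y → trans (sym (proj₂ (transpose s) y x)) (trans (same y x) (==F-sym y x))

  same-class : ∀ {w x y x′ y′} s → R w x y ≡ true → R w x′ y′ ≡ true → R s x y ≡ R s x′ y′
  same-class {w} s h h′ = ⇔→≡ (mk⇔ (transfer h h′) (transfer h′ h))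
    where
    transfer : ∀ {x y x′ y′} → R w x y ≡ true → R w x′ y′ ≡ true →
               R s x y ≡ true → R s x′ y′ ≡ true
    transfer {x} {y} {x′} {y′} h h′ r = trans (disjoint s w x y r h x′ y′) h′

  out-valency : ∀ s x x′ → countFin (R s x) ≡ countFin (R s x′)
  out-valency s x x′ = begin
    countFin (R s x)
      ≡⟨ countFin-cong (loop x) ⟨
    countFin (λ γ → R s x γ ∧ R s* γ x)
      ≡⟨ regular s s* Δ x x x′ x′ (R-Δ-refl x) (R-Δ-refl x′) ⟩
    countFin (λ γ → R s x′ γ ∧ R s* γ x′)
      ≡⟨ countFin-cong (loop x′) ⟩
    countFin (R s x′) ∎
    where
    s* = proj₁ (transpose s)
    loop : ∀ x γ → (R s x γ ∧ R s* γ x) ≡ R s x γ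
    loop x γ = trans (cong (R s x γ ∧_) (proj₂ (transpose s) γ x)) (∧-idem (R s x γ))

  in-valency : ∀ t y y′ → countFin (λ z → R t z y) ≡ countFin (λ z → R t z y′)
  in-valency t y y′ = begin
    countFin (λ γ → R t γ y)
      ≡⟨ countFin-cong (loop y) ⟨
    countFin (λ γ → R t* y γ ∧ R t γ y)
      ≡⟨ regular t* t Δ y y y′ y′ (R-Δ-refl y) (R-Δ-refl y′) ⟩
    countFin (λ γ → R t* y′ γ ∧ R t γ y′)
      ≡⟨ countFin-cong (loop y′) ⟩
    countFin (λ γ → R t γ y′) ∎
    where
    t* = proj₁ (transpose t)
    loop : ∀ y γ → (R t* y γ ∧ R t γ y) ≡ R t γ y
    loop y γ = trans (cong (_∧ R t γ y) (proj₂ (transpose t) y γ)) (∧-idem (R t γ y))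

-- Relations on X̃ given by a shape

data Law : Set where
  free  : Law
  shift : F₂ → Law

satisfies : Law → F₂ → Bool
satisfies free      _ = true
satisfies (shift g) p = p ==B g

record Shape (n : ℕ) : Set where
  constructor shape
  field
    layer : F₂
    base  : F₂ → Fin n → Fin n → Bool
    law   : F₂ → Fin n → Fin n → Law

open Shape

holds : ∀ {n} → Shape n → X̃ n → X̃ n → Bool
holds S (x , a , b) (y , c , d) =
  (c ==B (layer S xor a)) ∧ (base S a x y ∧ satisfies (law S a x y) (b xor d))

module _ {n} (S : Shape n) x a b y c d (h : holds S (x , a , b) (y , c , d) ≡ true) where
  private
    C = c ==B (layer S xor a)
    Z = base S a x y
    L = satisfies (law S a x y) (b xor d)

  holds-layer : c ≡ layer S xor a
  holds-layer = ==B⇒≡ (∧-conicalˡ C (Z ∧ L) h)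

  holds-base : Z ≡ true
  holds-base = ∧-conicalˡ Z L (∧-conicalʳ C (Z ∧ L) h)

  holds-law : L ≡ true
  holds-law = ∧-conicalʳ Z L (∧-conicalʳ C (Z ∧ L) h)

holds-intro : ∀ {n} (S : Shape n) x a b y c d → c ≡ layer S xor a → base S a x y ≡ true →
              satisfies (law S a x y) (b xor d) ≡ true → holds S (x , a , b) (y , c , d) ≡ true
holds-intro S x a b y c d refl z l = cong₂ _∧_ (==B-refl (layer S xor a)) (cong₂ _∧_ z l)

same-layer : ∀ {n} (S T : Shape n) α β → holds S α β ≡ true → holds T α β ≡ true →
             layer S ≡ layer T
same-layer S T (x , a , b) (y , c , d) h h′ =
  xor-cancelʳ a (trans (sym (holds-layer S x a b y c d h)) (holds-layer T x a b y c d h′))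

pairCount : Law → Law → F₂ → ℕ
pairCount free      free       _ = 2
pairCount free      (shift _)  _ = 1
pairCount (shift _) free       _ = 1
pairCount (shift g) (shift g′) p = b2n (p ==B (g xor g′))

countBool-cong : ∀ {p q : F₂ → Bool} → (∀ f → p f ≡ q f) → countBool p ≡ countBool q
countBool-cong p≗q = cong₂ ℕ._+_ (cong b2n (p≗q false)) (cong b2n (p≗q true))

unique-solution : ∀ d g → countBool (λ f → (f xor d) ==B g) ≡ 1
unique-solution false false = refl
unique-solution false true  = refl
unique-solution true  false = refl
unique-solution true  true  = refl

two-shifts : ∀ b d g g′ →
  countBool (λ f → ((b xor f) ==B g) ∧ ((f xor d) ==B g′)) ≡ b2n ((b xor d) ==B (g xor g′))
two-shifts false false false false = refl
two-shifts false false false true  = refl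
two-shifts false false true  false = refl
two-shifts false false true  true  = refl
two-shifts false true  false false = refl
two-shifts false true  false true  = refl
two-shifts false true  true  false = refl
two-shifts false true  true  true  = refl
two-shifts true  false false false = refl
two-shifts true  false false true  = refl
two-shifts true  false true  false = refl
two-shifts true  false true  true  = refl
two-shifts true  true  false false = refl
two-shifts true  true  false true  = refl
two-shifts true  true  true  false = refl
two-shifts true  true  true  true  = refl

countBool-pairCount : ∀ l l′ b d →
  countBool (λ f → satisfies l (b xor f) ∧ satisfies l′ (f xor d)) ≡ pairCount l l′ (b xor d)
countBool-pairCount free      free       b d = refl
countBool-pairCount free      (shift g′) b d = unique-solution d g′
countBool-pairCount (shift g) free       b d =
  trans (countBool-cong (λ f → trans (∧-identityʳ _) (cong (_==B g) (xor-comm b f))))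
        (unique-solution b g)
countBool-pairCount (shift g) (shift g′) b d = two-shifts b d g g′

select-layer : ∀ e₀ (A : F₂ → Bool) (B : F₂ → F₂ → Bool) →
  sumBool (λ e → countBool (λ f → ((e ==B e₀) ∧ A f) ∧ B e f))
  ≡ countBool (λ f → A f ∧ B e₀ f)
select-layer false A B = ℕP.+-identityʳ _
select-layer true  A B = refl

countBool-factor : ∀ C Z Z′ (L L′ : F₂ → Bool) →
  countBool (λ f → (Z ∧ L f) ∧ (C ∧ (Z′ ∧ L′ f)))
  ≡ b2n C ℕ.* (b2n (Z ∧ Z′) ℕ.* countBool (λ f → L f ∧ L′ f))
countBool-factor C     false Z′    L L′ = sym (ℕP.*-zeroʳ (b2n C))
countBool-factor false true  Z′    L L′ = countBool-cong (λ f → ∧-zeroʳ (L f))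
countBool-factor true  true  false L L′ = countBool-cong (λ f → ∧-zeroʳ (L f))
countBool-factor true  true  true  L L′ = sym (trans (ℕP.*-identityˡ _) (ℕP.*-identityˡ _))

pathCount : ∀ {n} → Shape n → Shape n → X̃ n → X̃ n → ℕ
pathCount S T (x , a , b) (y , _ , d) =
  sum (λ z → b2n (base S a x z ∧ base T a′ z y) ℕ.* pairCount (law S a x z) (law T a′ z y) (b xor d))
  where a′ = layer S xor a

countX̃-holds : ∀ {n} (S T : Shape n) x a b y c d →
  countX̃ (λ γ → holds S (x , a , b) γ ∧ holds T γ (y , c , d))
  ≡ b2n (c ==B (layer T xor (layer S xor a))) ℕ.* pathCount S T (x , a , b) (y , c , d)
countX̃-holds S T x a b y c d = begin
  countX̃ (λ γ → holds S α γ ∧ holds T γ β)  ≡⟨ sumℕ≡∑ fibre ⟩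
  sum fibre                                 ≡⟨ sum-cong-≗ fibre≡ ⟩
  sum (λ z → b2n C ℕ.* term z)              ≡⟨ ℕ∑.*-distribˡ-sum (b2n C) term ⟨
  b2n C ℕ.* pathCount S T α β               ∎
  where
  open ≡-Reasoning
  α = (x , a , b)
  β = (y , c , d)
  a′ = layer S xor a
  C = c ==B (layer T xor a′)
  fibre term : Fin _ → ℕ
  fibre z = sumBool (λ e → countBool (λ f → holds S α (z , e , f) ∧ holds T (z , e , f) β))
  term z = b2n (base S a x z ∧ base T a′ z y) ℕ.* pairCount (law S a x z) (law T a′ z y) (b xor d)
  fibre≡ : ∀ z → fibre z ≡ b2n C ℕ.* term z
  fibre≡ z = begin
    fibre z
      ≡⟨ select-layer a′ (λ f → Z ∧ L f) (λ e f → holds T (z , e , f) β) ⟩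
    countBool (λ f → (Z ∧ L f) ∧ (C ∧ (Z′ ∧ L′ f)))
      ≡⟨ countBool-factor C Z Z′ L L′ ⟩
    b2n C ℕ.* (b2n (Z ∧ Z′) ℕ.* countBool (λ f → L f ∧ L′ f))
      ≡⟨ cong (λ k → b2n C ℕ.* (b2n (Z ∧ Z′) ℕ.* k))
              (countBool-pairCount (law S a x z) (law T a′ z y) b d) ⟩
    b2n C ℕ.* term z ∎
    where
    Z = base S a x z
    Z′ = base T a′ z y
    L L′ : F₂ → Bool
    L f = satisfies (law S a x z) (b xor f)
    L′ f = satisfies (law T a′ z y) (f xor d)

scale-by-flag : ∀ k {m m′ : ℕ} → (k ≡ true → m ≡ m′) → b2n k ℕ.* m ≡ b2n k ℕ.* m′
scale-by-flag false _     = refl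
scale-by-flag true  m≡m′ = cong (1 ℕ.*_) (m≡m′ refl)

countX̃-cong : ∀ {n} {P Q : X̃ n → Bool} → (∀ γ → P γ ≡ Q γ) → countX̃ P ≡ countX̃ Q
countX̃-cong P≗Q = sumℕ-cong (λ x →
  cong₂ ℕ._+_ (countBool-cong (λ b → P≗Q (x , false , b)))
              (countBool-cong (λ b → P≗Q (x , true , b))))

cross-law : ∀ a c e p → ((oneMinusδ a c ℤ.* sgn e) ==ℤ sgn p) ≡ ((c ==B not a) ∧ (p ==B e))
cross-law false false false false = refl
cross-law false false false true  = refl
cross-law false false true  false = refl
cross-law false false true  true  = refl
cross-law false true  false false = refl
cross-law false true  false true  = refl
cross-law false true  true  false = refl
cross-law false true  true  true  = refl
cross-law true  false false false = refl
cross-law true  false false true  = refl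
cross-law true  false true  false = refl
cross-law true  false true  true  = refl
cross-law true  true  false false = refl
cross-law true  true  false true  = refl
cross-law true  true  true  false = refl
cross-law true  true  true  true  = refl

cross-law⁻ : ∀ a c e p →
  (not (a ==B c) ∧ not ((c ==B not a) ∧ (p ==B e))) ≡ ((c ==B not a) ∧ (p ==B not e))
cross-law⁻ false false e p = refl
cross-law⁻ false true  e p = not-==B p e
cross-law⁻ true  false e p = not-==B p e
cross-law⁻ true  true  e p = refl

module Construction {n : ℕ} {I : Set} {R : I → Fin n → Fin n → Bool}
                    (scheme : IsAssocScheme (Fin n) countFin I R)
                    {H : Fin n → Fin n → ℤ} (isHad : IsHadamard n H) where
  open IsAssocScheme scheme
  open SchemeFacts scheme
  open import Data.Nat.Base using (_*_)
  open ≡-Reasoning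

  ε : F₂ → Fin n → Fin n → F₂
  ε a x y = signBit (HT H a x y)

  ε-transpose : ∀ a x z → ε (not a) z x ≡ ε a x z
  ε-transpose false x z = refl
  ε-transpose true  x z = refl

  diagShape : F₂ → Shape n
  diagShape σ = shape false (λ _ x y → x ==F y) (λ _ _ _ → shift σ)

  inheritedShape : I → Shape n
  inheritedShape s = shape false (λ _ → R s) (λ _ _ _ → free)

  crossShape : F₂ → Shape n
  crossShape τ = shape true (λ _ _ _ → true) (λ a x y → shift (τ xor ε a x y))

  shapeOf : Ĩ I R → Shape n
  shapeOf one         = diagShape false
  shapeOf tt̃          = diagShape true
  shapeOf (tilde s _) = inheritedShape s
  shapeOf r⁺          = crossShape false
  shapeOf r⁻          = crossShape true

  data Kind : Shape n → Set where
    diagonal  : ∀ σ → Kind (diagShape σ)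
    inherited : ∀ s → ¬ SameRel (R s) _==F_ → Kind (inheritedShape s)
    crossing  : ∀ τ → Kind (crossShape τ)

  kindOf : ∀ u → Kind (shapeOf u)
  kindOf one           = diagonal false
  kindOf tt̃            = diagonal true
  kindOf (tilde s s≠Δ) = inherited s s≠Δ
  kindOf r⁺            = crossing false
  kindOf r⁻            = crossing true

  inR¹-cross : ∀ x a b y c d →
               inR¹ H (x , a , b) (y , c , d) ≡ ((c ==B not a) ∧ ((b xor d) ==B ε a x y))
  inR¹-cross x a b y c d =
    trans (cong (λ h → (oneMinusδ a c ℤ.* h) ==ℤ sgn (b xor d))
                (sym (sgn-signBit (IsHadamard.entries (HT-Hadamard isHad a) x y))))
          (cross-law a c (ε a x y) (b xor d))

  SH≡holds : ∀ u α β → SH I R H u α β ≡ holds (shapeOf u) α β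
  SH≡holds one (x , a , b) (y , c , d) =
    trans (∧-swapˡ (x ==F y) (a ==B c) (b ==B d))
          (cong₂ _∧_ (==B-sym a c) (cong ((x ==F y) ∧_) (==B-as-xor b d)))
  SH≡holds tt̃ (x , a , b) (y , c , d) =
    trans (∧-swapˡ (x ==F y) (a ==B c) (d ==B not b))
          (cong₂ _∧_ (==B-sym a c) (cong ((x ==F y) ∧_) (==B-not-as-xor b d)))
  SH≡holds (tilde s _) (x , a , b) (y , c , d) =
    trans (∧-comm (R s x y) (a ==B c)) (cong₂ _∧_ (==B-sym a c) (sym (∧-identityʳ (R s x y))))
  SH≡holds r⁺ (x , a , b) (y , c , d) = inR¹-cross x a b y c d
  SH≡holds r⁻ (x , a , b) (y , c , d) =
    trans (cong (λ w → not (a ==B c) ∧ not w) (inR¹-cross x a b y c d))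
          (cross-law⁻ a c (ε a x y) (b xor d))

  diagonal-pair : ∀ σ x a b y c d → holds (diagShape σ) (x , a , b) (y , c , d) ≡ true →
                  x ≡ y × b xor d ≡ σ
  diagonal-pair σ x a b y c d h = ==F⇒≡ (holds-base (diagShape σ) x a b y c d h)
                                , ==B⇒≡ (holds-law (diagShape σ) x a b y c d h)

  inherited-pair : ∀ {s} → ¬ SameRel (R s) _==F_ → ∀ x a b y c d →
                   holds (inheritedShape s) (x , a , b) (y , c , d) ≡ true → x ≢ y
  inherited-pair {s} s≠Δ x a b y c d h =
    non-Δ-irreflexive s≠Δ (holds-base (inheritedShape s) x a b y c d h)

  crossing-pair : ∀ τ x a b y c d → holds (crossShape τ) (x , a , b) (y , c , d) ≡ true →
                  b xor d ≡ τ xor ε a x y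
  crossing-pair τ x a b y c d h = ==B⇒≡ (holds-law (crossShape τ) x a b y c d h)

  module _ (x : Fin n) (a b : F₂) (y : Fin n) (c d : F₂) where
    private
      α = (x , a , b)
      β = (y , c , d)
      p = b xor d

    pathCount-diag-diag : ∀ σs σt → pathCount (diagShape σs) (diagShape σt) α β
                                    ≡ b2n (x ==F y) * b2n (p ==B (σs xor σt))
    pathCount-diag-diag σs σt = ∑-δˡ x (_==F y) (λ _ → b2n (p ==B (σs xor σt)))

    pathCount-diag-inh : ∀ σs t → pathCount (diagShape σs) (inheritedShape t) α β ≡ b2n (R t x y) * 1
    pathCount-diag-inh σs t = ∑-δˡ x (λ z → R t z y) (λ _ → 1)

    pathCount-diag-cross : ∀ σs τt → pathCount (diagShape σs) (crossShape τt) α β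
                                     ≡ b2n true * b2n (p ==B (σs xor (τt xor ε a x y)))
    pathCount-diag-cross σs τt =
      ∑-δˡ x (λ _ → true) (λ z → b2n (p ==B (σs xor (τt xor ε a z y))))

    pathCount-inh-diag : ∀ s σt → pathCount (inheritedShape s) (diagShape σt) α β ≡ b2n (R s x y) * 1
    pathCount-inh-diag s σt = ∑-δʳ y (R s x) (λ _ → 1)

    pathCount-inh-inh : ∀ s t → pathCount (inheritedShape s) (inheritedShape t) α β
                                ≡ countFin (λ z → R s x z ∧ R t z y) * 2
    pathCount-inh-inh s t = begin
      sum (λ z → b2n (R s x z ∧ R t z y) * 2)  ≡⟨ ℕ∑.*-distribʳ-sum 2 (b2n ∘ st) ⟨
      sum (b2n ∘ st) * 2                       ≡⟨ cong (_* 2) (sumℕ≡∑ (b2n ∘ st)) ⟨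
      countFin st * 2                          ∎
      where
      st = λ z → R s x z ∧ R t z y

    pathCount-inh-cross : ∀ s τt → pathCount (inheritedShape s) (crossShape τt) α β ≡ countFin (R s x)
    pathCount-inh-cross s τt = begin
      sum (λ z → b2n (R s x z ∧ true) * 1)
        ≡⟨ sum-cong-≗ (λ z → trans (ℕP.*-identityʳ _) (cong b2n (∧-identityʳ (R s x z)))) ⟩
      sum (b2n ∘ R s x)
        ≡⟨ sumℕ≡∑ (b2n ∘ R s x) ⟨
      countFin (R s x) ∎

    pathCount-cross-diag : ∀ τs σt → pathCount (crossShape τs) (diagShape σt) α β
                                     ≡ b2n true * b2n (p ==B ((τs xor ε a x y) xor σt))
    pathCount-cross-diag τs σt =
      ∑-δʳ y (λ _ → true) (λ z → b2n (p ==B ((τs xor ε a x z) xor σt)))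

    pathCount-cross-inh : ∀ τs t → pathCount (crossShape τs) (inheritedShape t) α β
                                   ≡ countFin (λ z → R t z y)
    pathCount-cross-inh τs t = begin
      sum (λ z → b2n (R t z y) * 1)  ≡⟨ sum-cong-≗ (λ z → ℕP.*-identityʳ (b2n (R t z y))) ⟩
      sum (λ z → b2n (R t z y))      ≡⟨ sumℕ≡∑ (λ z → b2n (R t z y)) ⟨
      countFin (λ z → R t z y)       ∎

    pathCount-cross-cross : ∀ τs τt → pathCount (crossShape τs) (crossShape τt) α β
                                      ≡ sum (λ z → b2n (p ==B ((τs xor τt) xor (ε a x z xor ε a y z))))
    pathCount-cross-cross τs τt = sum-cong-≗ λ z →
      trans (ℕP.*-identityˡ _) (cong (λ e → b2n (p ==B e)) (begin
        (τs xor ε a x z) xor (τt xor ε (not a) z y)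
          ≡⟨ cong (λ e → (τs xor ε a x z) xor (τt xor e)) (ε-transpose a y z) ⟩
        (τs xor ε a x z) xor (τt xor ε a y z)
          ≡⟨ xor-interchange τs (ε a x z) τt (ε a y z) ⟩
        (τs xor τt) xor (ε a x z xor ε a y z) ∎))

  record Invariant (S T U : Shape n) : Set where
    constructor invariant
    field
      on-pairs : ∀ α β α′ β′ → holds U α β ≡ true → holds U α′ β′ ≡ true →
                 pathCount S T α β ≡ pathCount S T α′ β′

  constant : ∀ {S T U} v →
             (∀ x a b y c d → holds U (x , a , b) (y , c , d) ≡ true →
                pathCount S T (x , a , b) (y , c , d) ≡ v) →
             Invariant S T U
  constant v ≡v = invariant λ where
    (x , a , b) (y , c , d) (x′ , a′ , b′) (y′ , c′ , d′) h h′ →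
      trans (≡v x a b y c d h) (sym (≡v x′ a′ b′ y′ c′ d′ h′))

  common-class : ∀ {U} → Kind U → layer U ≡ false → ∀ α β α′ β′ →
                 holds U α β ≡ true → holds U α′ β′ ≡ true →
                 Σ I λ w → R w (proj₁ α) (proj₁ β) ≡ true
                         × R w (proj₁ α′) (proj₁ β′) ≡ true
  common-class (diagonal σ) _ (x , a , b) (y , c , d) (x′ , a′ , b′) (y′ , c′ , d′) h h′
    with diagonal-pair σ x a b y c d h | diagonal-pair σ x′ a′ b′ y′ c′ d′ h′
  ... | refl , _ | refl , _ = Δ , R-Δ-refl x , R-Δ-refl x′
  common-class (inherited s _) _ (x , a , b) (y , c , d) (x′ , a′ , b′) (y′ , c′ , d′) h h′ =
    s , holds-base (inheritedShape s) x a b y c d h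
      , holds-base (inheritedShape s) x′ a′ b′ y′ c′ d′ h′

  class-determined : ∀ {S T U} → Kind U → layer U ≡ false →
    (∀ x a b y c d x′ a′ b′ y′ c′ d′ {w} → R w x y ≡ true → R w x′ y′ ≡ true →
       pathCount S T (x , a , b) (y , c , d) ≡ pathCount S T (x′ , a′ , b′) (y′ , c′ , d′)) →
    Invariant S T U
  class-determined kU flat by-class = invariant λ where
    α@(x , a , b) β@(y , c , d) α′@(x′ , a′ , b′) β′@(y′ , c′ , d′) h h′ →
      let (_ , r , r′) = common-class kU flat α β α′ β′ h h′
      in by-class x a b y c d x′ a′ b′ y′ c′ d′ r r′

  diag-diag-invariant : ∀ σs σt {U} → Kind U → layer U ≡ false → Invariant (diagShape σs) (diagShape σt) U
  diag-diag-invariant σs σt (diagonal τ) _ = constant (b2n (τ ==B (σs xor σt))) value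
    where
    value : ∀ x a b y c d → holds (diagShape τ) (x , a , b) (y , c , d) ≡ true →
            pathCount (diagShape σs) (diagShape σt) (x , a , b) (y , c , d) ≡ b2n (τ ==B (σs xor σt))
    value x a b y c d h with diagonal-pair τ x a b y c d h
    ... | refl , p≡τ = begin
      pathCount (diagShape σs) (diagShape σt) (x , a , b) (x , c , d)
        ≡⟨ pathCount-diag-diag x a b x c d σs σt ⟩
      b2n (x ==F x) * b2n ((b xor d) ==B (σs xor σt))
        ≡⟨ cong₂ (λ e q → b2n e * b2n (q ==B (σs xor σt))) (==F-refl x) p≡τ ⟩
      1 * b2n (τ ==B (σs xor σt))
        ≡⟨ ℕP.*-identityˡ _ ⟩
      b2n (τ ==B (σs xor σt)) ∎
  diag-diag-invariant σs σt (inherited s s≠Δ) _ = constant 0 λ x a b y c d h →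
    trans (pathCount-diag-diag x a b y c d σs σt)
          (cong (λ e → b2n e * b2n ((b xor d) ==B (σs xor σt)))
                (==F-≢ (inherited-pair s≠Δ x a b y c d h)))

  diag-inh-invariant : ∀ σs t {U} → Kind U → layer U ≡ false → Invariant (diagShape σs) (inheritedShape t) U
  diag-inh-invariant σs t kU flat = class-determined kU flat λ x a b y c d x′ a′ b′ y′ c′ d′ r r′ → begin
    pathCount (diagShape σs) (inheritedShape t) (x , a , b) (y , c , d)
      ≡⟨ pathCount-diag-inh x a b y c d σs t ⟩
    b2n (R t x y) * 1
      ≡⟨ cong (λ e → b2n e * 1) (same-class t r r′) ⟩
    b2n (R t x′ y′) * 1
      ≡⟨ pathCount-diag-inh x′ a′ b′ y′ c′ d′ σs t ⟨
    pathCount (diagShape σs) (inheritedShape t) (x′ , a′ , b′) (y′ , c′ , d′) ∎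

  diag-cross-invariant : ∀ σs τt {U} → Kind U → layer U ≡ true → Invariant (diagShape σs) (crossShape τt) U
  diag-cross-invariant σs τt (crossing τ) _ = constant (b2n (τ ==B (σs xor τt))) λ x a b y c d h → begin
    pathCount (diagShape σs) (crossShape τt) (x , a , b) (y , c , d)
      ≡⟨ pathCount-diag-cross x a b y c d σs τt ⟩
    1 * b2n ((b xor d) ==B (σs xor (τt xor ε a x y)))
      ≡⟨ ℕP.*-identityˡ _ ⟩
    b2n ((b xor d) ==B (σs xor (τt xor ε a x y)))
      ≡⟨ cong (λ q → b2n (q ==B (σs xor (τt xor ε a x y)))) (crossing-pair τ x a b y c d h) ⟩
    b2n ((τ xor ε a x y) ==B (σs xor (τt xor ε a x y)))
      ≡⟨ cong b2n (xor-shift-==B τ σs τt (ε a x y)) ⟩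
    b2n (τ ==B (σs xor τt)) ∎

  inh-diag-invariant : ∀ s σt {U} → Kind U → layer U ≡ false → Invariant (inheritedShape s) (diagShape σt) U
  inh-diag-invariant s σt kU flat = class-determined kU flat λ x a b y c d x′ a′ b′ y′ c′ d′ r r′ → begin
    pathCount (inheritedShape s) (diagShape σt) (x , a , b) (y , c , d)
      ≡⟨ pathCount-inh-diag x a b y c d s σt ⟩
    b2n (R s x y) * 1
      ≡⟨ cong (λ e → b2n e * 1) (same-class s r r′) ⟩
    b2n (R s x′ y′) * 1
      ≡⟨ pathCount-inh-diag x′ a′ b′ y′ c′ d′ s σt ⟨
    pathCount (inheritedShape s) (diagShape σt) (x′ , a′ , b′) (y′ , c′ , d′) ∎

  inh-inh-invariant : ∀ s t {U} → Kind U → layer U ≡ false → Invariant (inheritedShape s) (inheritedShape t) U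
  inh-inh-invariant s t kU flat = class-determined kU flat λ x a b y c d x′ a′ b′ y′ c′ d′ r r′ → begin
    pathCount (inheritedShape s) (inheritedShape t) (x , a , b) (y , c , d)
      ≡⟨ pathCount-inh-inh x a b y c d s t ⟩
    countFin (λ z → R s x z ∧ R t z y) * 2
      ≡⟨ cong (_* 2) (regular s t _ x y x′ y′ r r′) ⟩
    countFin (λ z → R s x′ z ∧ R t z y′) * 2
      ≡⟨ pathCount-inh-inh x′ a′ b′ y′ c′ d′ s t ⟨
    pathCount (inheritedShape s) (inheritedShape t) (x′ , a′ , b′) (y′ , c′ , d′) ∎

  inh-cross-invariant : ∀ s τt {U} → Invariant (inheritedShape s) (crossShape τt) U
  inh-cross-invariant s τt = invariant λ where
    (x , a , b) (y , c , d) (x′ , a′ , b′) (y′ , c′ , d′) _ _ →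
      trans (pathCount-inh-cross x a b y c d s τt)
            (trans (out-valency s x x′) (sym (pathCount-inh-cross x′ a′ b′ y′ c′ d′ s τt)))

  cross-diag-invariant : ∀ τs σt {U} → Kind U → layer U ≡ true → Invariant (crossShape τs) (diagShape σt) U
  cross-diag-invariant τs σt (crossing τ) _ = constant (b2n (τ ==B (σt xor τs))) λ x a b y c d h → begin
    pathCount (crossShape τs) (diagShape σt) (x , a , b) (y , c , d)
      ≡⟨ pathCount-cross-diag x a b y c d τs σt ⟩
    1 * b2n ((b xor d) ==B ((τs xor ε a x y) xor σt))
      ≡⟨ ℕP.*-identityˡ _ ⟩
    b2n ((b xor d) ==B ((τs xor ε a x y) xor σt))
      ≡⟨ cong₂ (λ q e → b2n (q ==B e)) (crossing-pair τ x a b y c d h)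
                                        (xor-comm (τs xor ε a x y) σt) ⟩
    b2n ((τ xor ε a x y) ==B (σt xor (τs xor ε a x y)))
      ≡⟨ cong b2n (xor-shift-==B τ σt τs (ε a x y)) ⟩
    b2n (τ ==B (σt xor τs)) ∎

  cross-inh-invariant : ∀ τs t {U} → Invariant (crossShape τs) (inheritedShape t) U
  cross-inh-invariant τs t = invariant λ where
    (x , a , b) (y , c , d) (x′ , a′ , b′) (y′ , c′ , d′) _ _ →
      trans (pathCount-cross-inh x a b y c d τs t)
            (trans (in-valency t y y′) (sym (pathCount-cross-inh x′ a′ b′ y′ c′ d′ τs t)))

  cross-cross-balanced : ∀ τs τt {s} → ¬ SameRel (R s) _==F_ → ∀ x a b y c d →
    holds (inheritedShape s) (x , a , b) (y , c , d) ≡ true →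
    2 * pathCount (crossShape τs) (crossShape τt) (x , a , b) (y , c , d) ≡ n
  cross-cross-balanced τs τt s≠Δ x a b y c d h =
    trans (cong (2 *_) (pathCount-cross-cross x a b y c d τs τt))
          (Hadamard.rows-balanced (HT-Hadamard isHad a) (inherited-pair s≠Δ x a b y c d h)
                                  (τs xor τt) (b xor d))

  cross-cross-invariant : ∀ τs τt {U} → Kind U → layer U ≡ false → Invariant (crossShape τs) (crossShape τt) U
  cross-cross-invariant τs τt (diagonal τ) _ = constant (sum {n} (λ _ → b2n (τ ==B (τs xor τt)))) value
    where
    value : ∀ x a b y c d → holds (diagShape τ) (x , a , b) (y , c , d) ≡ true →
            pathCount (crossShape τs) (crossShape τt) (x , a , b) (y , c , d)
            ≡ sum {n} (λ _ → b2n (τ ==B (τs xor τt)))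
    value x a b y c d h with diagonal-pair τ x a b y c d h
    ... | refl , p≡τ = trans (pathCount-cross-cross x a b x c d τs τt) (sum-cong-≗ λ z →
          cong₂ (λ q e → b2n (q ==B e)) p≡τ
                (trans (cong ((τs xor τt) xor_) (xor-same (ε a x z))) (xor-identityʳ (τs xor τt))))
  cross-cross-invariant τs τt (inherited s s≠Δ) _ = invariant λ where
    (x , a , b) (y , c , d) (x′ , a′ , b′) (y′ , c′ , d′) h h′ →
      ℕP.*-cancelˡ-≡ _ _ 2 (trans (cross-cross-balanced τs τt s≠Δ x a b y c d h)
                                   (sym (cross-cross-balanced τs τt s≠Δ x′ a′ b′ y′ c′ d′ h′)))

  pathCount-invariant : ∀ {S T U} → Kind S → Kind T → Kind U → layer U ≡ layer T xor layer S →
                        Invariant S T U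
  pathCount-invariant (diagonal σs)   (diagonal σt)   kU l = diag-diag-invariant σs σt kU l
  pathCount-invariant (diagonal σs)   (inherited t _) kU l = diag-inh-invariant σs t kU l
  pathCount-invariant (diagonal σs)   (crossing τt)   kU l = diag-cross-invariant σs τt kU l
  pathCount-invariant (inherited s _) (diagonal σt)   kU l = inh-diag-invariant s σt kU l
  pathCount-invariant (inherited s _) (inherited t _) kU l = inh-inh-invariant s t kU l
  pathCount-invariant (inherited s _) (crossing τt)   _  _ = inh-cross-invariant s τt
  pathCount-invariant (crossing τs)   (diagonal σt)   kU l = cross-diag-invariant τs σt kU l
  pathCount-invariant (crossing τs)   (inherited t _) _  _ = cross-inh-invariant τs t
  pathCount-invariant (crossing τs)   (crossing τt)   kU l = cross-cross-invariant τs τt kU l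

  holds-regular : ∀ {S T U} → Kind S → Kind T → Kind U → ∀ α β α′ β′ →
                  holds U α β ≡ true → holds U α′ β′ ≡ true →
                  countX̃ (λ γ → holds S α γ ∧ holds T γ β)
                  ≡ countX̃ (λ γ → holds S α′ γ ∧ holds T γ β′)
  holds-regular {S} {T} {U} kS kT kU α@(x , a , b) β@(y , c , d) α′@(x′ , a′ , b′) β′@(y′ , c′ , d′) h h′ =
    begin
    countX̃ (λ γ → holds S α γ ∧ holds T γ β)
      ≡⟨ countX̃-holds S T x a b y c d ⟩
    b2n (c ==B (layer T xor (layer S xor a))) * pathCount S T α β
      ≡⟨ cong (λ k → b2n k * pathCount S T α β) (layer-flag x a b y c d h) ⟩
    b2n flag * pathCount S T α β
      ≡⟨ scale-by-flag flag (λ eq →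
           Invariant.on-pairs (pathCount-invariant kS kT kU (==B⇒≡ eq)) α β α′ β′ h h′) ⟩
    b2n flag * pathCount S T α′ β′
      ≡⟨ cong (λ k → b2n k * pathCount S T α′ β′) (layer-flag x′ a′ b′ y′ c′ d′ h′) ⟨
    b2n (c′ ==B (layer T xor (layer S xor a′))) * pathCount S T α′ β′
      ≡⟨ countX̃-holds S T x′ a′ b′ y′ c′ d′ ⟨
    countX̃ (λ γ → holds S α′ γ ∧ holds T γ β′) ∎
    where
    flag = layer U ==B (layer T xor layer S)
    layer-flag : ∀ x a b y c d → holds U (x , a , b) (y , c , d) ≡ true →
                 (c ==B (layer T xor (layer S xor a))) ≡ flag
    layer-flag x a b y c d h = trans (cong (_==B (layer T xor (layer S xor a))) (holds-layer U x a b y c d h))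
                                     (xor-shift-==B (layer U) (layer T) (layer S) a)

  SH-regular : ∀ s t u α β α′ β′ → SH I R H u α β ≡ true → SH I R H u α′ β′ ≡ true →
               countX̃ (λ γ → SH I R H s α γ ∧ SH I R H t γ β)
               ≡ countX̃ (λ γ → SH I R H s α′ γ ∧ SH I R H t γ β′)
  SH-regular s t u α β α′ β′ h h′ = begin
    countX̃ (λ γ → SH I R H s α γ ∧ SH I R H t γ β)
      ≡⟨ countX̃-cong (λ γ → cong₂ _∧_ (SH≡holds s α γ) (SH≡holds t γ β)) ⟩
    countX̃ (λ γ → holds (shapeOf s) α γ ∧ holds (shapeOf t) γ β)
      ≡⟨ holds-regular (kindOf s) (kindOf t) (kindOf u) α β α′ β′
           (trans (sym (SH≡holds u α β)) h) (trans (sym (SH≡holds u α′ β′)) h′) ⟩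
    countX̃ (λ γ → holds (shapeOf s) α′ γ ∧ holds (shapeOf t) γ β′)
      ≡⟨ countX̃-cong (λ γ → cong₂ _∧_ (SH≡holds s α′ γ) (SH≡holds t γ β′)) ⟨
    countX̃ (λ γ → SH I R H s α′ γ ∧ SH I R H t γ β′) ∎

  diagIndex : ∀ σ → Σ (Ĩ I R) λ u → shapeOf u ≡ diagShape σ
  diagIndex false = one , refl
  diagIndex true  = tt̃ , refl

  crossIndex : ∀ τ → Σ (Ĩ I R) λ u → shapeOf u ≡ crossShape τ
  crossIndex false = r⁺ , refl
  crossIndex true  = r⁻ , refl

  realised-by : ∀ {S} → Σ (Ĩ I R) (λ u → shapeOf u ≡ S) → ∀ α β → holds S α β ≡ true →
                Σ (Ĩ I R) λ u → holds (shapeOf u) α β ≡ true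
  realised-by (u , refl) _ _ h = u , h

  classify : ∀ α β → Σ (Ĩ I R) λ u → holds (shapeOf u) α β ≡ true
  classify (x , a , b) (y , c , d) with c B.≟ a
  ... | no c≢a = realised-by (crossIndex τ) (x , a , b) (y , c , d)
                   (holds-intro (crossShape τ) x a b y c d (¬-not c≢a) refl signs-ok)
    where
    τ = (b xor d) xor ε a x y
    signs-ok : ((b xor d) ==B (τ xor ε a x y)) ≡ true
    signs-ok = subst (λ q → ((b xor d) ==B q) ≡ true) (sym (xor-xor-cancel (b xor d) (ε a x y)))
                     (==B-refl (b xor d))
  ... | yes refl with x Fin.≟ y
  ...   | yes refl = realised-by (diagIndex (b xor d)) (x , c , b) (x , c , d)
                       (holds-intro (diagShape (b xor d)) x c b x c d refl (==F-refl x) (==B-refl (b xor d)))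
  ...   | no x≢y = tilde s s≠Δ , holds-intro (inheritedShape s) x c b y c d refl r refl
    where
    s = proj₁ (cover x y)
    r = proj₂ (cover x y)
    s≠Δ : ¬ SameRel (R s) _==F_
    s≠Δ same = x≢y (==F⇒≡ (trans (sym (same x y)) r))

  holds-unique : ∀ {S S′} → Kind S → Kind S′ → ∀ α β → holds S α β ≡ true → holds S′ α β ≡ true →
                 ∀ γ δ → holds S γ δ ≡ holds S′ γ δ
  holds-unique (diagonal σ) (diagonal σ′) (x , a , b) (y , c , d) h h′ γ δ =
    cong (λ σ → holds (diagShape σ) γ δ)
         (trans (sym (proj₂ (diagonal-pair σ x a b y c d h))) (proj₂ (diagonal-pair σ′ x a b y c d h′)))
  holds-unique (inherited s _) (inherited s′ _) (x , a , b) (y , c , d) h h′ (x′ , a′ , b′) (y′ , c′ , d′) =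
    cong (λ r → (c′ ==B a′) ∧ (r ∧ true))
         (disjoint s s′ x y (holds-base (inheritedShape s) x a b y c d h)
                            (holds-base (inheritedShape s′) x a b y c d h′) x′ y′)
  holds-unique (crossing τ) (crossing τ′) (x , a , b) (y , c , d) h h′ γ δ =
    cong (λ τ → holds (crossShape τ) γ δ)
         (xor-cancelʳ {τ} {τ′} (ε a x y)
           (trans (sym (crossing-pair τ x a b y c d h)) (crossing-pair τ′ x a b y c d h′)))
  holds-unique (diagonal σ) (inherited s′ s′≠Δ) (x , a , b) (y , c , d) h h′ =
    ⊥-elim (inherited-pair s′≠Δ x a b y c d h′ (proj₁ (diagonal-pair σ x a b y c d h)))
  holds-unique (inherited s s≠Δ) (diagonal σ′) (x , a , b) (y , c , d) h h′ =
    ⊥-elim (inherited-pair s≠Δ x a b y c d h (proj₁ (diagonal-pair σ′ x a b y c d h′)))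
  holds-unique (diagonal σ) (crossing τ′) α β h h′
    with () ← same-layer (diagShape σ) (crossShape τ′) α β h h′
  holds-unique (inherited s _) (crossing τ′) α β h h′
    with () ← same-layer (inheritedShape s) (crossShape τ′) α β h h′
  holds-unique (crossing τ) (diagonal σ′) α β h h′
    with () ← same-layer (crossShape τ) (diagShape σ′) α β h h′
  holds-unique (crossing τ) (inherited s′ _) α β h h′
    with () ← same-layer (crossShape τ) (inheritedShape s′) α β h h′

  SH-disjoint : ∀ s s′ α β → SH I R H s α β ≡ true → SH I R H s′ α β ≡ true →
                SameRel (SH I R H s) (SH I R H s′)
  SH-disjoint s s′ α β h h′ γ δ = begin
    SH I R H s γ δ          ≡⟨ SH≡holds s γ δ ⟩
    holds (shapeOf s) γ δ   ≡⟨ holds-unique (kindOf s) (kindOf s′) α β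
                                 (trans (sym (SH≡holds s α β)) h) (trans (sym (SH≡holds s′ α β)) h′) γ δ ⟩
    holds (shapeOf s′) γ δ  ≡⟨ SH≡holds s′ γ δ ⟨
    SH I R H s′ γ δ         ∎

  SH-identity : ∀ α β → (SH I R H one α β ≡ true) ⇔ (α ≡ β)
  SH-identity (x , a , b) (y , c , d) = mk⇔ to from
    where
    to : SH I R H one (x , a , b) (y , c , d) ≡ true → (x , a , b) ≡ (y , c , d)
    to h with ==F⇒≡ (∧-conicalˡ (x ==F y) _ h)
            | ==B⇒≡ (∧-conicalˡ (a ==B c) (b ==B d) (∧-conicalʳ (x ==F y) _ h))
            | ==B⇒≡ (∧-conicalʳ (a ==B c) (b ==B d) (∧-conicalʳ (x ==F y) _ h))
    ... | refl | refl | refl = refl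
    from : (x , a , b) ≡ (y , c , d) → SH I R H one (x , a , b) (y , c , d) ≡ true
    from refl = cong₂ _∧_ (==F-refl x) (cong₂ _∧_ (==B-refl a) (==B-refl b))

  cross-symmetric : ∀ τ α β → holds (crossShape τ) α β ≡ holds (crossShape τ) β α
  cross-symmetric τ (x , false , b) (y , false , d) = refl
  cross-symmetric τ (x , false , b) (y , true  , d) = cong (_==B (τ xor ε false x y)) (xor-comm b d)
  cross-symmetric τ (x , true  , b) (y , false , d) = cong (_==B (τ xor ε true x y)) (xor-comm b d)
  cross-symmetric τ (x , true  , b) (y , true  , d) = refl

  SH-transpose : ∀ u → Σ (Ĩ I R) λ u* → ∀ α β → SH I R H u* α β ≡ SH I R H u β α
  SH-transpose one = one , λ where
    (x , a , b) (y , c , d) → cong₂ _∧_ (==F-sym x y) (cong₂ _∧_ (==B-sym a c) (==B-sym b d))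
  SH-transpose tt̃ = tt̃ , λ where
    (x , a , b) (y , c , d) → cong₂ _∧_ (==F-sym x y) (cong₂ _∧_ (==B-sym a c) (begin
      (d ==B not b)       ≡⟨ ==B-not-as-xor b d ⟩
      (b xor d) ==B true  ≡⟨ cong (_==B true) (xor-comm b d) ⟩
      (d xor b) ==B true  ≡⟨ ==B-not-as-xor d b ⟨
      (b ==B not d)       ∎))
  SH-transpose (tilde s s≠Δ) = tilde (proj₁ (transpose s)) (transpose-non-Δ s≠Δ) , λ where
    (x , a , b) (y , c , d) → cong₂ _∧_ (proj₂ (transpose s) x y) (==B-sym a c)
  SH-transpose r⁺ = r⁺ , λ α β →
    trans (SH≡holds r⁺ α β) (trans (cross-symmetric false α β) (sym (SH≡holds r⁺ β α)))
  SH-transpose r⁻ = r⁻ , λ α β →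
    trans (SH≡holds r⁻ α β) (trans (cross-symmetric true α β) (sym (SH≡holds r⁻ β α)))

  block-witness : ∀ u → Σ (X̃ n) λ α → Σ (X̃ n) λ β → holds (shapeOf u) α β ≡ true
  block-witness one = (x₀ , false , false) , (x₀ , false , false) ,
    holds-intro (diagShape false) x₀ false false x₀ false false refl (==F-refl x₀) refl
    where x₀ = nonempty
  block-witness tt̃ = (x₀ , false , false) , (x₀ , false , true) ,
    holds-intro (diagShape true) x₀ false false x₀ false true refl (==F-refl x₀) refl
    where x₀ = nonempty
  block-witness (tilde s _) with blockNonempty s
  ... | x , y , r = (x , false , false) , (y , false , false) ,
    holds-intro (inheritedShape s) x false false y false false refl r refl
  block-witness r⁺ = (x₀ , false , false) , (x₀ , true , e) ,
    holds-intro (crossShape false) x₀ false false x₀ true e refl refl (==B-refl e)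
    where
    x₀ = nonempty
    e = ε false x₀ x₀
  block-witness r⁻ = (x₀ , false , false) , (x₀ , true , not e) ,
    holds-intro (crossShape true) x₀ false false x₀ true (not e) refl refl (==B-refl (not e))
    where
    x₀ = nonempty
    e = ε false x₀ x₀

  isAssocScheme : IsAssocScheme (X̃ n) countX̃ (Ĩ I R) (SH I R H)
  isAssocScheme = record
    { nonempty      = nonempty , false , false
    ; blockNonempty = λ u → let (α , β , h) = block-witness u in α , β , trans (SH≡holds u α β) h
    ; cover         = λ α β → let (u , h) = classify α β in u , trans (SH≡holds u α β) h
    ; disjoint      = SH-disjoint
    ; identity      = one , SH-identity
    ; transpose     = SH-transpose
    ; regular       = SH-regular
    }

theorem1p1 : (n : ℕ) (I : Set) (R : I → Fin n → Fin n → Bool) →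
    IsAssocScheme (Fin n) countFin I R →
    (H : Fin n → Fin n → ℤ) → IsHadamard n H →
    IsAssocScheme (X̃ n) countX̃ (Ĩ I R) (SH I R H)
theorem1p1 n I R scheme H isHad = Construction.isAssocScheme scheme isHad
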